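{- Let $D$ be a digraph with maximum out-degree $\Delta_o$, let $r$ be an integer, and suppose we have a partial proper coloring of $D$ using at most $\Delta_o + 1 - r$ colors. Suppose that for every vertex $v$ there are at least $r$ colors each of which appears on at least two vertices of $N^{+}(v)$. Then $D$ is $(\Delta_o + 1 - r)$-colorable.
   Context: All digraphs are finite and simple (no loops, no two arcs with the same initial and the same terminal vertex). $N^{+}(v)$ is the set of out-neighbors of $v$, i.e. the vertices $u$ with $vu$ an arc. A set $A \subseteq V(D)$ is acyclic if $D[A]$ has no directed cycle. A partial proper coloring is an assignment of colors to a subset of the vertices such that each color class induces an acyclic subdigraph. $D$ is $k$-colorable if $V(D)$ can be partitioned into $k$ acyclic sets. -}

module Defs where

open import Data.Nat using (ℕ; zero; suc; _⊔_)
open import Data.Bool using (Bool; true; false; _∧_; if_then_else_; T)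
open import Data.Fin using (Fin; zero; suc; inject₁; fromℕ)
open import Data.Fin.Properties using (_≟_)
open import Data.Maybe using (Maybe; just; nothing)
open import Data.Product using (Σ; _×_)
open import Relation.Nullary using (¬_; does)
open import Relation.Binary.PropositionalEquality using (_≡_)
open import Function.Definitions using (Injective)

-- A finite simple digraph on vertex set Fin n: an adjacency relation
-- (arc v u = true iff vu is an arc) with no loops.  Multiple arcs are
-- impossible by construction.
record Digraph : Set where
  field
    n        : ℕ
    arc      : Fin n → Fin n → Bool
    loopless : (v : Fin n) → arc v v ≡ false
open Digraph public

count : {k : ℕ} → (Fin k → Bool) → ℕ
count {zero}  p = 0
count {suc k} p = (if p zero then 1 else 0) Data.Nat.+ count (λ i → p (suc i))

maxFin : {k : ℕ} → (Fin k → ℕ) → ℕ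
maxFin {zero}  f = 0
maxFin {suc k} f = f zero ⊔ maxFin (λ i → f (suc i))

outDeg : (D : Digraph) → Fin (n D) → ℕ
outDeg D v = count (arc D v)

maxOutDeg : Digraph → ℕ
maxOutDeg D = maxFin (outDeg D)

record DirectedCycle (D : Digraph) : Set where
  field
    len      : ℕ
    w        : Fin (suc len) → Fin (n D)
    distinct : Injective _≡_ _≡_ w
    step     : (i : Fin len) → T (arc D (w (inject₁ i)) (w (suc i)))
    close    : T (arc D (w (fromℕ len)) (w zero))

Acyclic : (D : Digraph) → (Fin (n D) → Set) → Set
Acyclic D A = ¬ (Σ (DirectedCycle D) λ C →
                   (i : Fin (suc (DirectedCycle.len C))) → A (DirectedCycle.w C i))

-- Partial proper coloring with colors from Fin m (so at most m colors):
-- each vertex gets a color or nothing; every color class is acyclic.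
PartialProper : (D : Digraph) (m : ℕ) → (Fin (n D) → Maybe (Fin m)) → Set
PartialProper D m col = (c : Fin m) → Acyclic D (λ v → col v ≡ just c)

-- D is k-colorable: V(D) partitions into k acyclic sets (some possibly empty).
Colorable : Digraph → ℕ → Set
Colorable D k = Σ (Fin (n D) → Fin k) λ col →
                  (c : Fin k) → Acyclic D (λ v → col v ≡ c)

hasColor : {m : ℕ} → Maybe (Fin m) → Fin m → Bool
hasColor nothing  c = false
hasColor (just d) c = does (d ≟ c)

repeatedColors : (D : Digraph) {m : ℕ} → (Fin (n D) → Maybe (Fin m)) → Fin (n D) → ℕ
repeatedColors D {m} col v =
  count {m} λ c → Data.Nat._≤ᵇ_ 2 (count (λ u → arc D v u ∧ hasColor (col u) c))

-- Color the uncolored vertices greedily, one at a time.  Let v be uncolored and let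
-- a_c be the number of out-neighbors of v of color c.  Double counting gives
-- Σ_c a_c ≤ d⁺(v) ≤ Δ_o, whereas if every one of the k = Δ_o + 1 - r colors occurred in
-- N⁺(v) we would get Σ_c a_c ≥ k + #{c : a_c ≥ 2} ≥ Δ_o + 1.  So some color c is
-- missing from N⁺(v), and giving it to v creates no monochromatic cycle: on such a cycle
-- the successor of v would be an out-neighbor of v of color c.  Coloring more vertices
-- only increases the number of repeated colors, so the argument can be iterated.
module Submission where

open import Defs
open import Data.Nat using (ℕ; suc)
open import Data.Integer using (ℤ; +_; _-_; _≤_)
open import Data.Fin using (Fin)
open import Data.Maybe using (Maybe)
open import Data.Product using (Σ; _×_)
open import Relation.Binary.PropositionalEquality using (_≡_)

import Data.Nat.Properties as ℕ
open import Algebra.Properties.CommutativeSemigroup ℕ.+-commutativeSemigroup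
  using (x∙yz≈y∙xz)
open import Algebra.Properties.CommutativeMonoid.Sum ℕ.+-0-commutativeMonoid
  using (sum; sum-syntax; sum-cong-≗; sum-replicate-zero; ∑-comm)
open import Data.Bool using (Bool; true; false; T; _∧_; if_then_else_)
open import Data.Bool.Properties using (T-∧)
open import Data.Empty using (⊥-elim)
open import Data.Fin using (zero; suc; inject₁; fromℕ; _↑ˡ_)
open import Data.Fin.Properties using (_≟_; any?; ↑ˡ-injective)
import Data.Integer as ℤ
import Data.Integer.Properties as ℤ
open import Data.List using (List; []; _∷_; allFin)
open import Data.List.Membership.Propositional.Properties using (∈-allFin)
open import Data.List.Relation.Unary.All using (All; []; _∷_; lookup)
open import Data.Maybe using (just; nothing; map)
open import Data.Maybe.Properties using (just-injective; map-injective)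
open import Data.Nat using (zero; _+_; _<_; z≤n; s≤s; _≤ᵇ_)
  renaming (_≤_ to _≤ℕ_)
open import Data.Product using (∃-syntax; _,_; proj₁; proj₂)
open import Data.Sum using (_⊎_; inj₁; inj₂)
open import Data.Unit using (tt)
open import Data.Vec.Functional using (updateAt)
open import Data.Vec.Functional.Properties using (updateAt-updates; updateAt-minimal)
open import Function using (_∘_; id; const; module Equivalence)
open import Function.Definitions using (Injective)
open import Relation.Binary.PropositionalEquality
  using (refl; sym; trans; cong; cong₂; subst; subst₂; _≢_; module ≡-Reasoning)
open import Relation.Nullary using (yes; no; does; contradiction)
open import Relation.Nullary.Decidable using (dec-true)

open Equivalence using (to; from)

indicator : Bool → ℕ
indicator b = if b then 1 else 0

indicator-mono : {a b : Bool} → (T a → T b) → indicator a ≤ℕ indicator b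
indicator-mono {false}         _   = z≤n
indicator-mono {true}  {true}  _   = ℕ.≤-refl
indicator-mono {true}  {false} a⇒b = ⊥-elim (a⇒b tt)

∑-mono-≤ : {k : ℕ} {f g : Fin k → ℕ} → (∀ i → f i ≤ℕ g i) → sum f ≤ℕ sum g
∑-mono-≤ {zero}  f≤g = z≤n
∑-mono-≤ {suc k} f≤g = ℕ.+-mono-≤ (f≤g zero) (∑-mono-≤ (f≤g ∘ suc))

count≡∑ : {k : ℕ} (p : Fin k → Bool) → count p ≡ ∑[ i < k ] indicator (p i)
count≡∑ {zero}  p = refl
count≡∑ {suc k} p = cong (_+_ (indicator (p zero))) (count≡∑ (p ∘ suc))

count-mono : {k : ℕ} (p q : Fin k → Bool) → (∀ i → T (p i) → T (q i)) → count p ≤ℕ count q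
count-mono p q p⇒q =
  subst₂ _≤ℕ_ (sym (count≡∑ p)) (sym (count≡∑ q)) (∑-mono-≤ (indicator-mono ∘ p⇒q))

count-pos : {k : ℕ} (p : Fin k → Bool) (i : Fin k) → T (p i) → 0 < count p
count-pos p zero    pi with p zero
... | true = s≤s z≤n
count-pos p (suc i) pi = ℕ.≤-trans (count-pos (p ∘ suc) i pi) (ℕ.m≤n+m _ _)

count-↑ˡ : {m : ℕ} (j : ℕ) (p : Fin (m + j) → Bool) → count {m} (λ c → p (c ↑ˡ j)) ≤ℕ count p
count-↑ˡ {zero}  j p = z≤n
count-↑ˡ {suc m} j p = ℕ.+-monoʳ-≤ (indicator (p zero)) (count-↑ˡ j (p ∘ suc))

maxFin-upper : {k : ℕ} (f : Fin k → ℕ) (i : Fin k) → f i ≤ℕ maxFin f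
maxFin-upper f zero    = ℕ.m≤m⊔n _ _
maxFin-upper f (suc i) = ℕ.≤-trans (maxFin-upper (f ∘ suc) i) (ℕ.m≤n⊔m _ _)

hasColor⇒≡just : {k : ℕ} (x : Maybe (Fin k)) (c : Fin k) → T (hasColor x c) → x ≡ just c
hasColor⇒≡just (just d) c d≡c with d ≟ c
... | yes refl = refl

hasColor-just : {k : ℕ} (c : Fin k) → T (hasColor (just c) c)
hasColor-just c rewrite dec-true (c ≟ c) refl = tt

atLeastTwice-mono : {a b : ℕ} → a ≤ℕ b → T (2 ≤ᵇ a) → T (2 ≤ᵇ b)
atLeastTwice-mono {a} a≤b 2≤a = ℕ.≤⇒≤ᵇ (ℕ.≤-trans (ℕ.≤ᵇ⇒≤ 2 a 2≤a) a≤b)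

∑-indicator-≟ : {k : ℕ} (d : Fin k) → ∑[ c < k ] indicator (does (d ≟ c)) ≡ 1
∑-indicator-≟ {suc k} zero    = cong suc (sum-replicate-zero k)
∑-indicator-≟         (suc d) = ∑-indicator-≟ d

∑-indicator-hasColor : {k : ℕ} (b : Bool) (x : Maybe (Fin k)) →
  ∑[ c < k ] indicator (b ∧ hasColor x c) ≤ℕ indicator b
∑-indicator-hasColor {k} false x        = ℕ.≤-reflexive (sum-replicate-zero k)
∑-indicator-hasColor {k} true  nothing  = ℕ.≤-trans (ℕ.≤-reflexive (sum-replicate-zero k)) z≤n
∑-indicator-hasColor     true  (just d) = ℕ.≤-reflexive (∑-indicator-≟ d)

∑-colorClasses≤count : {n k : ℕ} (p : Fin n → Bool) (x : Fin n → Maybe (Fin k)) →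
  ∑[ c < k ] count (λ u → p u ∧ hasColor (x u) c) ≤ℕ count p
∑-colorClasses≤count {n} {k} p x = begin
  ∑[ c < k ] count (λ u → p u ∧ hasColor (x u) c)
    ≡⟨ sum-cong-≗ (λ c → count≡∑ (λ u → p u ∧ hasColor (x u) c)) ⟩
  ∑[ c < k ] ∑[ u < n ] indicator (p u ∧ hasColor (x u) c)
    ≡⟨ ∑-comm (λ c u → indicator (p u ∧ hasColor (x u) c)) ⟩
  ∑[ u < n ] ∑[ c < k ] indicator (p u ∧ hasColor (x u) c)
    ≤⟨ ∑-mono-≤ (λ u → ∑-indicator-hasColor (p u) (x u)) ⟩
  ∑[ u < n ] indicator (p u)
    ≡⟨ count≡∑ p ⟨
  count p
    ∎
  where open ℕ.≤-Reasoning

suc-indicator-twice≤ : (a : ℕ) → a ≢ 0 → suc (indicator (2 ≤ᵇ a)) ≤ℕ a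
suc-indicator-twice≤ zero          a≢0 = contradiction refl a≢0
suc-indicator-twice≤ (suc zero)    _   = ℕ.≤-refl
suc-indicator-twice≤ (suc (suc a)) _   = s≤s (s≤s z≤n)

+count-twice≤∑ : {k : ℕ} (g : Fin k → ℕ) → (∀ c → g c ≢ 0) →
  k + count (λ c → 2 ≤ᵇ g c) ≤ℕ ∑[ c < k ] g c
+count-twice≤∑ {zero}  g g≢0 = z≤n
+count-twice≤∑ {suc k} g g≢0 = begin
  suc k + (indicator (2 ≤ᵇ g zero) + count (λ c → 2 ≤ᵇ g (suc c)))
    ≡⟨ cong suc (x∙yz≈y∙xz k (indicator (2 ≤ᵇ g zero)) _) ⟩
  suc (indicator (2 ≤ᵇ g zero)) + (k + count (λ c → 2 ≤ᵇ g (suc c)))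
    ≤⟨ ℕ.+-mono-≤ (suc-indicator-twice≤ (g zero) (g≢0 zero))
                  (+count-twice≤∑ (g ∘ suc) (g≢0 ∘ suc)) ⟩
  g zero + ∑[ c < k ] g (suc c)
    ∎
  where open ℕ.≤-Reasoning

missingColor : {n k : ℕ} (p : Fin n → Bool) (x : Fin n → Maybe (Fin k)) →
  count p < k + count (λ c → 2 ≤ᵇ count (λ u → p u ∧ hasColor (x u) c)) →
  ∃[ c ] count (λ u → p u ∧ hasColor (x u) c) ≡ 0
missingColor p x few with any? (λ c → count (λ u → p u ∧ hasColor (x u) c) ℕ.≟ 0)
... | yes missing = missing
... | no  none    = contradiction
  (ℕ.≤-trans (+count-twice≤∑ _ (λ c e → none (c , e))) (∑-colorClasses≤count p x))
  (ℕ.<⇒≱ few)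

inject₁-or-fromℕ : (l : ℕ) (i : Fin (suc l)) → i ≡ fromℕ l ⊎ ∃[ j ] i ≡ inject₁ j
inject₁-or-fromℕ zero    zero    = inj₁ refl
inject₁-or-fromℕ (suc l) zero    = inj₂ (zero , refl)
inject₁-or-fromℕ (suc l) (suc i) with inject₁-or-fromℕ l i
... | inj₁ i≡l       = inj₁ (cong suc i≡l)
... | inj₂ (j , i≡j) = inj₂ (suc j , cong suc i≡j)

module _ (D : Digraph) where

  open DirectedCycle

  cycle-successor : (C : DirectedCycle D) (i : Fin (suc (len C))) →
    ∃[ i′ ] T (arc D (w C i) (w C i′))
  cycle-successor C i with inject₁-or-fromℕ (len C) i
  ... | inj₁ refl       = zero , close C
  ... | inj₂ (j , refl) = suc j , step C j

  Coloring : ℕ → Set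
  Coloring k = Fin (n D) → Maybe (Fin k)

  outMultiplicity : {k : ℕ} → Coloring k → Fin (n D) → Fin k → ℕ
  outMultiplicity col v c = count (λ u → arc D v u ∧ hasColor (col u) c)

  outMultiplicity-pos : {k : ℕ} (col : Coloring k) {v u : Fin (n D)} {c : Fin k} →
    T (arc D v u) → col u ≡ just c → 0 < outMultiplicity col v c
  outMultiplicity-pos col {v} {u} {c} vu u↦c =
    count-pos (λ x → arc D v x ∧ hasColor (col x) c) u
    (T-∧ .from (vu , subst (λ x → T (hasColor x c)) (sym u↦c) (hasColor-just c)))

  outMultiplicity-mono : {k l : ℕ} (col : Coloring k) (col′ : Coloring l) {c : Fin k} {c′ : Fin l} →
    (∀ {u} → col u ≡ just c → col′ u ≡ just c′) →
    ∀ v → outMultiplicity col v c ≤ℕ outMultiplicity col′ v c′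
  outMultiplicity-mono col col′ {c} {c′} c⇒c′ v =
    count-mono (λ u → arc D v u ∧ hasColor (col u) c) (λ u → arc D v u ∧ hasColor (col′ u) c′)
      λ u vu∧u↦c →
        let (vu , u↦c) = T-∧ .to vu∧u↦c
        in T-∧ .from (vu , subst (λ x → T (hasColor x c′))
                                 (sym (c⇒c′ (hasColor⇒≡just _ c u↦c))) (hasColor-just c′))

  isRepeated : {k : ℕ} → Coloring k → Fin (n D) → Fin k → Bool
  isRepeated col v c = 2 ≤ᵇ outMultiplicity col v c

  _⊑_ : {k : ℕ} → Coloring k → Coloring k → Set
  col ⊑ col′ = ∀ {u c} → col u ≡ just c → col′ u ≡ just c

  repeatedColors-mono : {k : ℕ} {col col′ : Coloring k} → col ⊑ col′ →
    ∀ v → repeatedColors D col v ≤ℕ repeatedColors D col′ v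
  repeatedColors-mono {col = col} {col′} col⊑col′ v =
    count-mono (isRepeated col v) (isRepeated col′ v) λ c →
      atLeastTwice-mono (outMultiplicity-mono col col′ col⊑col′ v)

  repeatedColors-↑ˡ : {m : ℕ} (j : ℕ) (col : Coloring m) →
    ∀ v → repeatedColors D col v ≤ℕ repeatedColors D (map (_↑ˡ j) ∘ col) v
  repeatedColors-↑ˡ j col v = ℕ.≤-trans
    (count-mono (isRepeated col v) (λ c → isRepeated col′ v (c ↑ˡ j)) λ c →
      atLeastTwice-mono (outMultiplicity-mono col col′ (cong (map (_↑ˡ j))) v))
    (count-↑ˡ j (isRepeated col′ v))
    where
    col′ = map (_↑ˡ j) ∘ col

  PartialProper-map : {m k : ℕ} {f : Fin m → Fin k} → Injective _≡_ _≡_ f →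
    (col : Coloring m) → PartialProper D m col → PartialProper D k (map f ∘ col)
  PartialProper-map {f = f} f-inj col proper d (C , monochromatic)
    with col (w C zero) | monochromatic zero
  ... | just c | fc≡d = proper c
    (C , λ i → map-injective f-inj (trans (monochromatic i) (sym fc≡d)))

  recolor-proper : {k : ℕ} {col : Coloring k} {v : Fin (n D)} {c : Fin k} →
    PartialProper D k col → outMultiplicity col v c ≡ 0 →
    PartialProper D k (updateAt col v (const (just c)))
  recolor-proper {col = col} {v} {c} proper c-missing d (C , monochromatic)
    with any? (λ i → w C i ≟ v)
  ... | no v∉C = proper d (C , λ i →
    trans (sym (updateAt-minimal _ v col (v∉C ∘ (i ,_)))) (monochromatic i))
  ... | yes (i , wᵢ≡v) with cycle-successor C i
  ... | i′ , wᵢwᵢ′ with w C i′ ≟ v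
  ...   | yes wᵢ′≡v = subst T (trans (cong₂ (arc D) wᵢ≡v wᵢ′≡v) (loopless D v)) wᵢwᵢ′
  ...   | no  wᵢ′≢v = contradiction c-missing
    (ℕ.>⇒≢ (outMultiplicity-pos col (subst (λ x → T (arc D x (w C i′))) wᵢ≡v wᵢwᵢ′) wᵢ′↦c))
    where
    d≡c : d ≡ c
    d≡c = just-injective (begin
      just d                                  ≡⟨ monochromatic i ⟨
      updateAt col v (const (just c)) (w C i) ≡⟨ cong (updateAt col v (const (just c))) wᵢ≡v ⟩
      updateAt col v (const (just c)) v       ≡⟨ updateAt-updates v col ⟩
      just c                                  ∎)
      where open ≡-Reasoning
    wᵢ′↦c : col (w C i′) ≡ just c
    wᵢ′↦c = trans (sym (updateAt-minimal _ v col wᵢ′≢v))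
                  (trans (monochromatic i′) (cong just d≡c))

  record GreedyState (k : ℕ) : Set where
    field
      coloring : Coloring k
      proper   : PartialProper D k coloring
      -- the hypothesis r ≤ repeatedColors of the theorem, for r = Δ_o + 1 - k
      spare    : ∀ v → suc (maxOutDeg D) ≤ℕ k + repeatedColors D coloring v
  open GreedyState

  Colored : {k : ℕ} → Coloring k → Fin (n D) → Set
  Colored col v = ∃[ c ] col v ≡ just c

  colorVertex : {k : ℕ} (s : GreedyState k) (v : Fin (n D)) →
    Σ (GreedyState k) λ s′ → coloring s ⊑ coloring s′ × Colored (coloring s′) v
  colorVertex s v with coloring s v in v↦
  ... | just c  = s , id , c , v↦
  ... | nothing = s′ , col⊑col′ , c , updateAt-updates v col
    where
    col = coloring s
    free : ∃[ c ] outMultiplicity col v c ≡ 0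
    free = missingColor (arc D v) col (ℕ.≤-trans (s≤s (maxFin-upper (outDeg D) v)) (spare s v))
    c = proj₁ free
    col′ = updateAt col v (const (just c))
    col⊑col′ : col ⊑ col′
    col⊑col′ {u} u↦d with u ≟ v
    ... | yes refl = contradiction (trans (sym u↦d) v↦) λ ()
    ... | no  u≢v  = trans (updateAt-minimal u v col u≢v) u↦d
    s′ : GreedyState _
    s′ = record
      { coloring = col′
      ; proper   = recolor-proper (proper s) (proj₂ free)
      ; spare    = λ u → ℕ.≤-trans (spare s u) (ℕ.+-monoʳ-≤ _ (repeatedColors-mono col⊑col′ u))
      }

  colorAll : {k : ℕ} (s : GreedyState k) (vs : List (Fin (n D))) →
    Σ (GreedyState k) λ s′ → coloring s ⊑ coloring s′ × All (Colored (coloring s′)) vs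
  colorAll s []       = s , id , []
  colorAll s (v ∷ vs) with colorVertex s v
  ... | s₁ , s⊑s₁ , (c , v↦c) with colorAll s₁ vs
  ... | s₂ , s₁⊑s₂ , colored = s₂ , s₁⊑s₂ ∘ s⊑s₁ , (c , s₁⊑s₂ v↦c) ∷ colored

  greedyColoring : {k : ℕ} → GreedyState k → Colorable D k
  greedyColoring s with colorAll s (allFin (n D))
  ... | s′ , _ , colored = color , λ c (C , monochromatic) → proper s′ c
    (C , λ i → trans (proj₂ (colored-at (w C i))) (cong just (monochromatic i)))
    where
    colored-at : ∀ v → Colored (coloring s′) v
    colored-at v = lookup colored (∈-allFin v)
    color : Fin (n D) → Fin _
    color = proj₁ ∘ colored-at

m-r≡k∧r≤q⇒m≤k+q : {m k q : ℕ} (r : ℤ) → + m - r ≡ + k → r ≤ + q → m ≤ℕ k + q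
m-r≡k∧r≤q⇒m≤k+q {m} {k} {q} r m-r≡k r≤q = ℤ.drop‿+≤+ (begin
  + m                  ≡⟨ k+r≡m ⟨
  + k ℤ.+ r            ≤⟨ ℤ.+-monoʳ-≤ (+ k) r≤q ⟩
  + k ℤ.+ + q          ≡⟨ ℤ.pos-+ k q ⟨
  + (k + q)            ∎)
  where
  open ℤ.≤-Reasoning
  k+r≡m : + k ℤ.+ r ≡ + m
  k+r≡m = begin-equality
    + k ℤ.+ r             ≡⟨ cong (ℤ._+ r) m-r≡k ⟨
    (+ m - r) ℤ.+ r       ≡⟨ ℤ.+-assoc (+ m) (ℤ.- r) r ⟩
    + m ℤ.+ (ℤ.- r ℤ.+ r) ≡⟨ cong (ℤ._+_ (+ m)) (ℤ.+-inverseˡ r) ⟩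
    + m ℤ.+ ℤ.0ℤ          ≡⟨ ℤ.+-identityʳ (+ m) ⟩
    + m                   ∎

lemma1 : (D : Digraph) (r : ℤ) (m : ℕ) (col : Fin (n D) → Maybe (Fin m))
    → + m ≤ + suc (maxOutDeg D) - r
    → PartialProper D m col
    → ((v : Fin (n D)) → r ≤ + repeatedColors D col v)
    → Σ ℕ λ k → (+ k ≡ + suc (maxOutDeg D) - r) × Colorable D k
lemma1 D r m col m≤k proper r≤repeated with + suc (maxOutDeg D) - r in Δ+1-r≡k
... | ℤ.-[1+ _ ] with () ← m≤k
... | + k with ℕ.m≤n⇒∃[o]m+o≡n (ℤ.drop‿+≤+ m≤k)
... | j , refl = m + j , refl , greedyColoring D record
  { coloring = map (_↑ˡ j) ∘ col
  ; proper   = PartialProper-map D (↑ˡ-injective j _ _) col proper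
  ; spare    = λ v → m-r≡k∧r≤q⇒m≤k+q r Δ+1-r≡k
      (ℤ.≤-trans (r≤repeated v) (ℤ.+≤+ (repeatedColors-↑ˡ D j col v)))
  }
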